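{- Let $\mathbf P=(P,+,\bar{}\,,\tilde{}\,,0,1)$ be a good monotonous pseudoeffect algebra with induced order $\leq$. Let $\mathbb R(\mathbf P)=(P,\leq,\odot,\rightarrow,\leadsto,\bar{}\,,\tilde{}\,,0,1)$ where $x\odot y:=\widetilde{\bar x+\bar y}$ (defined iff $\tilde x\leq y$), $x\rightarrow y:=\{\bar x+u\mid u\in L(x,y)\}$ and $x\leadsto y:=\{u+\tilde x\mid u\in L(x,y)\}$, and let $\mathbb P(\mathbb R(\mathbf P))=(P,\oplus,\bar{}\,,\tilde{}\,,0,1)$ where $x\oplus y:=\widetilde{\bar x\odot\bar y}$, defined if and only if $x\leq\bar y$. Then $\mathbb P(\mathbb R(\mathbf P))=\mathbf P$, i.e. for all $a,b\in P$, $a\oplus b$ is defined iff $a+b$ is defined, and in this case $a\oplus b=a+b$.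
   Context: A pseudoeffect algebra is a partial algebra $(P,+,\bar{}\,,\tilde{}\,,0,1)$ of type $(2,1,1,0,0)$ where $(P,\bar{}\,,\tilde{}\,,0,1)$ is an algebra and $+$ is a partial binary operation such that for all $x,y,z\in P$: (P1) if $x+y$ is defined then there exist $u,w\in P$ with $u+x=y+w=x+y$; (P2) $(x+y)+z$ is defined iff $x+(y+z)$ is defined, and then they are equal; (P3) $\bar x$ is the unique $u$ with $u+x=1$ and $\tilde x$ is the unique $w$ with $x+w=1$; (P4) if $1+x$ or $x+1$ is defined then $x=0$. The induced order is $x\leq y$ iff there is $z$ with $x+z=y$. We write $\widetilde{t}$ and $\overline{t}$ for the unary operations applied to a term $t$. For $A\subseteq P$: $L(A)=\{x\mid x\leq y\ \forall y\in A\}$, $U(A)=\{x\mid y\leq x\ \forall y\in A\}$, $L(a,b)=L(\{a,b\})$. For subsets $A,B$, $A\leq B$ means $x\leq y$ for all $x\in A,y\in B$; $x+A=\{x+y\mid y\in A\}$, $A+x=\{y+x\mid y\in A\}$. $\mathbf P$ is good if $\widetilde{\bar x+\bar y}=\overline{\tilde x+\tilde y}$ for all $x,y\in P$ with $\tilde x\leq y$. $\mathbf P$ is monotonous if for all $x\in P$ and non-empty $A,B\subseteq P$: $A\cup B\leq\bar x$ and $L(A)\leq U(B)$ imply $L(A+x)\leq U(B+x)$; and $A\cup B\leq\tilde x$ and $L(A)\leq U(B)$ imply $L(x+A)\leq U(x+B)$. -}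

module Defs where

open import Level using (0ℓ)
open import Data.Product using (Σ; ∃; _×_; _,_)
open import Relation.Binary.PropositionalEquality using (_≡_)
open import Relation.Unary using (Pred)

-- A pseudoeffect algebra.  The partial binary operation + is represented by
-- its graph  Sum x y z  ("x + y is defined and equals z"), required to be
-- functional.
record PseudoEffectAlgebra : Set₁ where
  field
    P    : Set
    Sum  : P → P → P → Set
    bar  : P → P
    tld  : P → P
    𝟘    : P
    𝟙    : P
    Sum-functional : ∀ {x y z z'} → Sum x y z → Sum x y z' → z ≡ z'
    P1 : ∀ {x y s} → Sum x y s → (∃ λ u → Sum u x s) × (∃ λ w → Sum y w s)
    P2→ : ∀ {x y z s t} → Sum x y s → Sum s z t →
          ∃ λ v → Sum y z v × Sum x v t
    P2← : ∀ {x y z v t} → Sum y z v → Sum x v t →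
          ∃ λ s → Sum x y s × Sum s z t
    P3-bar      : ∀ x → Sum (bar x) x 𝟙
    P3-bar-uniq : ∀ {x u} → Sum u x 𝟙 → u ≡ bar x
    P3-tld      : ∀ x → Sum x (tld x) 𝟙
    P3-tld-uniq : ∀ {x w} → Sum x w 𝟙 → w ≡ tld x
    P4ˡ : ∀ {x s} → Sum 𝟙 x s → x ≡ 𝟘
    P4ʳ : ∀ {x s} → Sum x 𝟙 s → x ≡ 𝟘

module _ (𝐏 : PseudoEffectAlgebra) where
  open PseudoEffectAlgebra 𝐏

  _≤_ : P → P → Set
  x ≤ y = ∃ λ z → Sum x z y

  L : Pred P 0ℓ → Pred P 0ℓ
  L A x = ∀ y → A y → x ≤ y

  U : Pred P 0ℓ → Pred P 0ℓ
  U A x = ∀ y → A y → y ≤ x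

  _≤ˢ_ : Pred P 0ℓ → Pred P 0ℓ → Set
  A ≤ˢ B = ∀ x y → A x → B y → x ≤ y

  _∪_≤ᵉ_ : Pred P 0ℓ → Pred P 0ℓ → P → Set
  A ∪ B ≤ᵉ x = (∀ y → A y → y ≤ x) × (∀ y → B y → y ≤ x)

  _+ˢ_ : Pred P 0ℓ → P → Pred P 0ℓ
  (A +ˢ x) z = ∃ λ y → A y × Sum y x z

  _ˢ+_ : P → Pred P 0ℓ → Pred P 0ℓ
  (x ˢ+ A) z = ∃ λ y → A y × Sum x y z

  NonEmpty : Pred P 0ℓ → Set
  NonEmpty A = ∃ λ x → A x

  Good : Set
  Good = ∀ x y s t → tld x ≤ y → Sum (bar x) (bar y) s → Sum (tld x) (tld y) t →
         tld s ≡ bar t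

  Monotonous : Set₁
  Monotonous = ∀ (x : P) (A B : Pred P 0ℓ) → NonEmpty A → NonEmpty B →
    ((A ∪ B ≤ᵉ bar x) → L A ≤ˢ U B → L (A +ˢ x) ≤ˢ U (B +ˢ x)) ×
    ((A ∪ B ≤ᵉ tld x) → L A ≤ˢ U B → L (x ˢ+ A) ≤ˢ U (x ˢ+ B))

  Odot : P → P → P → Set
  Odot x y z = tld x ≤ y × (∃ λ s → Sum (bar x) (bar y) s × z ≡ tld s)

  L₂ : P → P → Pred P 0ℓ
  L₂ x y u = u ≤ x × u ≤ y

  Arrow : P → P → Pred P 0ℓ
  Arrow x y z = ∃ λ u → L₂ x y u × Sum (bar x) u z

  Squig : P → P → Pred P 0ℓ
  Squig x y z = ∃ λ u → L₂ x y u × Sum u (tld x) z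

  Oplus : P → P → P → Set
  Oplus x y z = x ≤ bar y × (∃ λ w → Odot (bar x) (bar y) w × z ≡ tld w)

-- Unfolding the definitions, a ⊕ b = ~~(x̄ + ȳ) with x = ā, y = b̄, defined iff a ≤ b̄, i.e. iff
-- a + b is defined.  Since ~x = a and ~y = b, goodness for the pair (ā, b̄) turns ~(x̄ + ȳ)
-- into ‾(a + b), and ~‾ is the identity.
module Submission where

open import Defs
open import Data.Product using (_×_; _,_; ∃)
open import Relation.Binary.PropositionalEquality
  using (_≡_; refl; sym; trans; cong; subst; subst₂)

module PseudoEffectAlgebraProperties (𝐏 : PseudoEffectAlgebra) where
  open PseudoEffectAlgebra 𝐏

  infix 4 _≤ᴾ_
  _≤ᴾ_ : P → P → Set
  _≤ᴾ_ = _≤_ 𝐏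

  tld-bar : ∀ x → tld (bar x) ≡ x
  tld-bar x = sym (P3-tld-uniq (P3-bar x))

  ≤bar⇒Sum : ∀ {x y} → x ≤ᴾ bar y → ∃ (Sum x y)
  ≤bar⇒Sum {y = y} (_ , x+z≡ȳ) with P1 x+z≡ȳ
  ... | (u , u+x≡ȳ) , _ with P2→ u+x≡ȳ (P3-bar y)
  ... | c , x+y≡c , _ = c , x+y≡c

  Sum⇒≤bar : ∀ {x y c} → Sum x y c → x ≤ᴾ bar y
  Sum⇒≤bar {c = c} x+y≡c with P2← x+y≡c (P3-bar c)
  ... | t , c̄+x≡t , t+y≡𝟙 with P3-bar-uniq t+y≡𝟙
  ... | refl = let _ , (w , x+w≡ȳ) = P1 c̄+x≡t in w , x+w≡ȳ

  bar-antitone : ∀ {x y} → x ≤ᴾ y → bar y ≤ᴾ bar x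
  bar-antitone {y = y} (_ , x+z≡y) with P1 x+z≡y
  ... | (u , u+x≡y) , _ with P2← u+x≡y (P3-bar y)
  ... | t , ȳ+u≡t , t+x≡𝟙 with P3-bar-uniq t+x≡𝟙
  ... | refl = u , ȳ+u≡t

  bar-bar-Sum : ∀ {a b c} → Sum a b c → ∃ (Sum (bar (bar a)) (bar (bar b)))
  bar-bar-Sum a+b≡c = ≤bar⇒Sum (bar-antitone (bar-antitone (Sum⇒≤bar a+b≡c)))

  tld-tld-Sum-bar-bar : Good 𝐏 → ∀ {a b c s} →
    Sum a b c → Sum (bar (bar a)) (bar (bar b)) s → tld (tld s) ≡ c
  tld-tld-Sum-bar-bar good {a} {b} {c} {s} a+b≡c s-sum =
    trans (cong tld tld-s≡c̄) (tld-bar c)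
    where
    tld-s≡c̄ : tld s ≡ bar c
    tld-s≡c̄ = good (bar a) (bar b) s c
      (subst (_≤ᴾ bar b) (sym (tld-bar a)) (Sum⇒≤bar a+b≡c))
      s-sum
      (subst₂ (λ x y → Sum x y c) (sym (tld-bar a)) (sym (tld-bar b)) a+b≡c)

  Oplus⇒Sum : Good 𝐏 → ∀ {a b z} → Oplus 𝐏 a b z → Sum a b z
  Oplus⇒Sum good (a≤b̄ , _ , (_ , s , s-sum , refl) , refl) =
    let c , a+b≡c = ≤bar⇒Sum a≤b̄
    in subst (Sum _ _) (sym (tld-tld-Sum-bar-bar good a+b≡c s-sum)) a+b≡c

  Sum⇒Oplus : Good 𝐏 → ∀ {a b z} → Sum a b z → Oplus 𝐏 a b z
  Sum⇒Oplus good {a} {b} a+b≡z with bar-bar-Sum a+b≡z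
  ... | s , s-sum =
    a≤b̄ , tld s ,
    (subst (_≤ᴾ bar b) (sym (tld-bar a)) a≤b̄ , s , s-sum , refl) ,
    sym (tld-tld-Sum-bar-bar good a+b≡z s-sum)
    where
    a≤b̄ : a ≤ᴾ bar b
    a≤b̄ = Sum⇒≤bar a+b≡z

theorem6 : (𝐏 : PseudoEffectAlgebra) → Good 𝐏 → Monotonous 𝐏 →
    ∀ a b z → (Oplus 𝐏 a b z → PseudoEffectAlgebra.Sum 𝐏 a b z) ×
    (PseudoEffectAlgebra.Sum 𝐏 a b z → Oplus 𝐏 a b z)
theorem6 𝐏 good _ a b z = Oplus⇒Sum good , Sum⇒Oplus good
  where open PseudoEffectAlgebraProperties 𝐏
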